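{- Let $n\ge 1$, $k\ge 0$, $m\ge 0$ be integers. The number of plane trees with $n$ edges, $k$ internal nodes, and exactly $m$ internal nodes of degree larger than one equals $w_{n,k,m}$, where $$w_{n,k,m}=\begin{cases}\frac{1}{k}\binom{n}{k-1}\binom{n-k-1}{m-1}\binom{k}{m}, & \text{if } m>0,\ m\le k,\ k+m\le n,\\ 1, & \text{if } m=0 \text{ and } n=k,\\ 0, & \text{otherwise.}\end{cases}$$
   Context: A plane tree is a rooted tree in which the children of each vertex are linearly ordered (left to right). The degree of a vertex is its number of children. A leaf is a vertex of degree $0$; an internal node is a vertex of degree at least $1$ (the root counts as an internal node if it has children). -}

module Defs where

open import Data.Nat using (ℕ; zero; suc; _+_; _*_; _∸_; _/_; _≡ᵇ_; _≤ᵇ_)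
open import Data.Nat.Combinatorics using (_C_)
open import Data.List using (List; []; _∷_; length)
open import Data.Bool using (if_then_else_; _∧_)

data PlaneTree : Set where
  node : List PlaneTree → PlaneTree

mutual
  edges : PlaneTree → ℕ
  edges (node ts) = length ts + edgesL ts

  edgesL : List PlaneTree → ℕ
  edgesL [] = 0
  edgesL (t ∷ ts) = edges t + edgesL ts

mutual
  internalNodes : PlaneTree → ℕ
  internalNodes (node []) = 0
  internalNodes (node (t ∷ ts)) = 1 + internalNodesL (t ∷ ts)

  internalNodesL : List PlaneTree → ℕ
  internalNodesL [] = 0
  internalNodesL (t ∷ ts) = internalNodes t + internalNodesL ts

mutual
  bigNodes : PlaneTree → ℕ
  bigNodes (node []) = 0
  bigNodes (node (t ∷ [])) = bigNodesL (t ∷ [])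
  bigNodes (node (t ∷ u ∷ ts)) = 1 + bigNodesL (t ∷ u ∷ ts)

  bigNodesL : List PlaneTree → ℕ
  bigNodesL [] = 0
  bigNodesL (t ∷ ts) = bigNodes t + bigNodesL ts

-- w_{n,k,m}.  In the case m > 0, m ≤ k, k + m ≤ n we have k = suc k' ≥ 1,
-- and (1/k)·C(n,k-1)·C(n-k-1,m-1)·C(k,m) is computed as an exact natural-number quotient.
w : ℕ → ℕ → ℕ → ℕ
w n k zero = if n ≡ᵇ k then 1 else 0
w n zero (suc m') = 0
w n (suc k') (suc m') =
  if (suc m' ≤ᵇ suc k') ∧ (suc k' + suc m' ≤ᵇ n)
  then ((n C k') * ((n ∸ suc k' ∸ 1) C m') * (suc k' C suc m')) / suc k'
  else 0

-- Listing the degrees of a plane tree in preorder gives its Łukasiewicz word: a word d₁ … d_{n+1} with sum n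
-- in which every proper prefix has sum at least its length. Under this bijection edges, internal nodes and
-- nodes of degree ≥ 2 become the sum, the number of letters ≥ 1 and the number of letters ≥ 2. By the cycle
-- lemma, exactly one of the n + 1 rotations of any word of length n + 1 and sum n is a Łukasiewicz word, so
-- (n + 1) · #trees is the number of all such words. Those are counted directly: choose the k positions of
-- the positive letters (C(n + 1, k) ways), among them the m letters ≥ 2 (C(k, m) ways), and the excesses
-- d − 2 of these m letters, a weak composition of n − k − m into m parts (C(n − k − 1, m − 1) ways).
-- Dividing by n + 1 with k · C(n + 1, k) = (n + 1) · C(n, k − 1) gives w.
module Submission where

open import Defs
open import Axiom.UniquenessOfIdentityProofs.WithK using (uip)
open import Data.Bool using (true; false; if_then_else_)
open import Data.Empty using (⊥-elim)
open import Data.Fin using (Fin; zero; suc; toℕ; fromℕ<; _≟_)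
open import Data.Fin.Properties
  using (+↔⊎; *↔×; cantor-schröder-bernstein; toℕ-fromℕ<; toℕ<n; toℕ-injective)
open import Data.List using (List; []; _∷_; _++_; length; take; drop)
open import Data.List.Properties
  using (++-assoc; ++-identityʳ; length-++; length-take; length-drop; take-all; take++drop≡id; ∷-injective)
open import Data.Maybe using (Maybe; just; nothing)
open import Data.Nat
  using (ℕ; zero; suc; pred; _+_; _*_; _∸_; _/_; _⊓_; _≤_; _<_; _≤?_; _<ᵇ_; _≡ᵇ_; _≤ᵇ_; s≤s; s≤s⁻¹)
open import Data.Nat.Combinatorics
  using (_C_; nCk+nC[k+1]≡[n+1]C[k+1]; k>n⇒nCk≡0; nCn≡1; nC1≡n; nCk≡nC[n∸k])
open import Data.Nat.DivMod using (m*n/n≡m)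
open import Data.Nat.ListAction using (sum)
open import Data.Nat.ListAction.Properties using (sum-++)
open import Data.Nat.Properties
  using ( suc-injective; ≤-reflexive; ≰⇒>; n≤1+n; m≤m+n; m≤n+m; m≤n⇒m⊓n≡m; m≤n⇒∃[o]m+o≡n; m≢1+n+m
        ; +-suc; +-assoc; +-comm; +-identityʳ; +-cancelʳ-≡; m+n∸m≡n; m+n∸n≡m
        ; *-assoc; *-comm; *-identityˡ; *-identityʳ; *-zeroʳ; *-distribˡ-+; *-cancelˡ-≡
        ; ≡ᵇ⇒≡; ≡⇒≡ᵇ; ≤ᵇ-reflects-≤; +-commutativeSemigroup; *-commutativeSemigroup )
open import Algebra.Properties.CommutativeSemigroup +-commutativeSemigroup
  using () renaming (x∙yz≈y∙xz to +-left-comm)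
open import Algebra.Properties.CommutativeSemigroup *-commutativeSemigroup
  using () renaming (x∙yz≈y∙xz to *-left-comm)
open import Data.Product using (Σ; _×_; _,_; proj₁; proj₂)
open import Data.Product.Properties using (Σ-≡,≡→≡)
open import Data.Product.Function.Dependent.Propositional using (Σ-↔; congˡ)
open import Data.Product.Function.NonDependent.Propositional using (_×-↔_)
open import Data.Sum using (_⊎_; inj₁; inj₂; [_,_])
open import Data.Sum.Function.Propositional using (_⊎-↔_)
open import Function using (_∘_; id)
open import Function.Bundles using (_↔_; Inverse; Injection; mk↔ₛ′)
open import Function.Properties.Inverse using (↔-refl; ↔-sym; ↔-trans; ↔⇒↣)
open import Function.Related.Propositional using (module EquationalReasoning; ≡⇒)
open import Function.Related.TypeIsomorphisms using (Σ-assoc; ×-distribʳ-⊎)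
open import Relation.Binary.PropositionalEquality
  using (_≡_; refl; sym; trans; cong; cong₂; subst; module ≡-Reasoning)
open import Relation.Nullary using (¬_; Irrelevant; Dec; yes; no; contradiction)
open import Relation.Nullary.Decidable using (_×-dec_)
open import Relation.Nullary.Reflects using (Reflects; ofʸ; ofⁿ; fromEquivalence)

variable
  A B : Set
  P Q : A → Set
  m n : ℕ

×-irrelevant : Irrelevant A → Irrelevant B → Irrelevant (A × B)
×-irrelevant irrA irrB (a , b) (a′ , b′) = cong₂ _,_ (irrA a a′) (irrB b b′)

irrelevant-↔ : Irrelevant A → Irrelevant B → (A → B) → (B → A) → A ↔ B
irrelevant-↔ irrA irrB f g = mk↔ₛ′ f g (λ _ → irrB _ _) (λ _ → irrA _ _)

suc-≡-↔ : (suc m ≡ suc n) ↔ (m ≡ n)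
suc-≡-↔ = irrelevant-↔ uip uip suc-injective (cong suc)

Σ-irrelevant-↔ : (∀ x → Irrelevant (P x)) → (∀ y → Irrelevant (Q y)) →
  (to : Σ A P → Σ B Q) (from : Σ B Q → Σ A P) →
  (∀ y → proj₁ (to (from y)) ≡ proj₁ y) → (∀ x → proj₁ (from (to x)) ≡ proj₁ x) →
  Σ A P ↔ Σ B Q
Σ-irrelevant-↔ irrP irrQ to from to∘from from∘to = mk↔ₛ′ to from
  (λ y → Σ-≡,≡→≡ (to∘from y , irrQ _ _ _))
  (λ x → Σ-≡,≡→≡ (from∘to x , irrP _ _ _))

⊎-emptyʳ-↔ : ¬ B → (A ⊎ B) ↔ A
⊎-emptyʳ-↔ ¬b = mk↔ₛ′ [ id , ⊥-elim ∘ ¬b ] inj₁ (λ _ → refl)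
  (λ { (inj₁ a) → refl ; (inj₂ b) → ⊥-elim (¬b b) })

Σ-×-factorˡ : {C : A → Set} → Σ A (λ a → B × C a) ↔ (B × Σ A C)
Σ-×-factorˡ = mk↔ₛ′ (λ (a , b , c) → b , a , c) (λ (b , a , c) → a , b , c) (λ _ → refl) (λ _ → refl)

Σ-ℕ-↔ : {P : ℕ → Set} → Σ ℕ P ↔ (P zero ⊎ Σ ℕ (P ∘ suc))
Σ-ℕ-↔ = mk↔ₛ′
  (λ { (zero , p) → inj₁ p ; (suc x , p) → inj₂ (x , p) })
  (λ { (inj₁ p) → zero , p ; (inj₂ (x , p)) → suc x , p })
  (λ { (inj₁ p) → refl ; (inj₂ (x , p)) → refl })
  (λ { (zero , p) → refl ; (suc x , p) → refl })

Σ-List-[]-↔ : {P : List A → Set} → Σ (List A) (λ v → length v ≡ 0 × P v) ↔ P []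
Σ-List-[]-↔ = mk↔ₛ′ (λ { ([] , _ , p) → p }) (λ p → [] , refl , p)
  (λ _ → refl) (λ { ([] , refl , p) → refl })

Σ-List-∷-↔ : {P : List A → Set} →
  Σ (List A) (λ v → length v ≡ suc n × P v) ↔ Σ A (λ x → Σ (List A) (λ v → length v ≡ n × P (x ∷ v)))
Σ-List-∷-↔ = mk↔ₛ′
  (λ { (x ∷ v , l , p) → x , v , suc-injective l , p })
  (λ (x , v , l , p) → x ∷ v , cong suc l , p)
  (λ (x , v , l , p) → cong (λ l → x , v , l , p) (uip _ _))
  (λ { (x ∷ v , l , p) → cong (λ l → x ∷ v , l , p) (uip _ _) })

Σ-Fin-suc-↔ : {P : Fin (suc n) → Set} → Σ (Fin (suc n)) P ↔ (P zero ⊎ Σ (Fin n) (P ∘ suc))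
Σ-Fin-suc-↔ = mk↔ₛ′
  (λ { (zero , p) → inj₁ p ; (suc x , p) → inj₂ (x , p) })
  (λ { (inj₁ p) → zero , p ; (inj₂ (x , p)) → suc x , p })
  (λ { (inj₁ p) → refl ; (inj₂ (x , p)) → refl })
  (λ { (zero , p) → refl ; (suc x , p) → refl })

Fin-↔⇒≡ : Fin m ↔ Fin n → m ≡ n
Fin-↔⇒≡ f = cantor-schröder-bernstein (Injection.injective (↔⇒↣ f)) (Injection.injective (↔⇒↣ (↔-sym f)))

decidable-finite : Dec A → Irrelevant A → Σ ℕ (λ c → A ↔ Fin c)
decidable-finite (yes a) irr = 1 , mk↔ₛ′ (λ _ → zero) (λ _ → a) (λ { zero → refl }) (irr a)
decidable-finite (no ¬a) _   = 0 , mk↔ₛ′ (⊥-elim ∘ ¬a) (λ ()) (λ ()) (⊥-elim ∘ ¬a)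

decidable-subset-finite : (∀ x → Dec (P x)) → (∀ x → Irrelevant (P x)) → Σ ℕ (λ c → Σ (Fin n) P ↔ Fin c)
decidable-subset-finite {n = zero}  _  _   = 0 , mk↔ₛ′ (λ ()) (λ ()) (λ ()) (λ ())
decidable-subset-finite {n = suc n} P? irr
  with decidable-finite (P? zero) (irr zero) | decidable-subset-finite (P? ∘ suc) (irr ∘ suc)
... | a , P₀↔a | c , rest↔c = a + c , ↔-trans Σ-Fin-suc-↔ (↔-trans (P₀↔a ⊎-↔ rest↔c) (↔-sym +↔⊎))

-- A is in bijection with the decidable subset of Fin n whose preimages have first component zero.
Fin-×-cancelˡ : (Fin (suc m) × A) ↔ Fin n → Σ ℕ (λ c → A ↔ Fin c × suc m * c ≡ n)
Fin-×-cancelˡ {m} {A} {n} f = c , A↔c , Fin-↔⇒≡ (↔-trans *↔× (↔-trans (↔-refl ×-↔ ↔-sym A↔c) f))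
  where
  slice : A ↔ Σ (Fin (suc m) × A) (λ p → proj₁ p ≡ zero)
  slice = mk↔ₛ′ (λ a → (zero , a) , refl) (proj₂ ∘ proj₁) (λ { ((zero , a) , refl) → refl }) (λ _ → refl)
  first-zero? : ∀ x → Dec (proj₁ (Inverse.from f x) ≡ zero)
  first-zero? x = proj₁ (Inverse.from f x) ≟ zero
  counted : Σ ℕ (λ c → Σ (Fin n) (λ x → proj₁ (Inverse.from f x) ≡ zero) ↔ Fin c)
  counted = decidable-subset-finite first-zero? (λ _ → uip)
  c : ℕ
  c = proj₁ counted
  A↔c : A ↔ Fin c
  A↔c = ↔-trans slice (↔-trans (↔-sym (Σ-↔ (↔-sym f) ↔-refl)) (proj₂ counted))

-- Łukasiewicz words

countAbove : ℕ → List ℕ → ℕ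
countAbove j []       = 0
countAbove j (x ∷ xs) = if j <ᵇ x then suc (countAbove j xs) else countAbove j xs

countAbove-++ : ∀ j xs ys → countAbove j (xs ++ ys) ≡ countAbove j xs + countAbove j ys
countAbove-++ j []       ys = refl
countAbove-++ j (x ∷ xs) ys with j <ᵇ x
... | true  = cong suc (countAbove-++ j xs ys)
... | false = countAbove-++ j xs ys

Stats : ℕ → ℕ → ℕ → List ℕ → Set
Stats n k m w = sum w ≡ n × countAbove 0 w ≡ k × countAbove 1 w ≡ m

Stats-irrelevant : ∀ {n k m} w → Irrelevant (Stats n k m w)
Stats-irrelevant w = ×-irrelevant uip (×-irrelevant uip uip)

-- Reading a letter d fills one open slot and opens d new ones; reading with no open slot fails.
openSlots : ℕ → List ℕ → Maybe ℕ
openSlots r       []      = just r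
openSlots zero    (d ∷ w) = nothing
openSlots (suc r) (d ∷ w) = openSlots (d + r) w

IsŁukasiewicz : List ℕ → Set
IsŁukasiewicz w = openSlots 1 w ≡ just 0

openSlots-++ : ∀ r a b {h} → openSlots r a ≡ just h → openSlots r (a ++ b) ≡ openSlots h b
openSlots-++ r       []      b refl = refl
openSlots-++ (suc r) (d ∷ a) b e    = openSlots-++ (d + r) a b e

mutual
  degrees : PlaneTree → List ℕ
  degrees (node ts) = length ts ∷ degreesL ts

  degreesL : List PlaneTree → List ℕ
  degreesL []       = []
  degreesL (t ∷ ts) = degrees t ++ degreesL ts

-- A stack machine reading the word from the right: the letter d pops d trees and pushes their parent.
decodeForest : List ℕ → List PlaneTree
decodeForest []      = []
decodeForest (d ∷ w) = node (take d (decodeForest w)) ∷ drop d (decodeForest w)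

decode : List ℕ → PlaneTree
decode []      = node []
decode (d ∷ w) = node (take d (decodeForest w))

take-length-++ : (xs ys : List A) → take (length xs) (xs ++ ys) ≡ xs
take-length-++ []       ys = refl
take-length-++ (x ∷ xs) ys = cong (x ∷_) (take-length-++ xs ys)

drop-length-++ : (xs ys : List A) → drop (length xs) (xs ++ ys) ≡ ys
drop-length-++ []       ys = refl
drop-length-++ (x ∷ xs) ys = drop-length-++ xs ys

degreesL-++ : ∀ ts us → degreesL (ts ++ us) ≡ degreesL ts ++ degreesL us
degreesL-++ []       us = refl
degreesL-++ (t ∷ ts) us =
  trans (cong (degrees t ++_) (degreesL-++ ts us)) (sym (++-assoc (degrees t) (degreesL ts) (degreesL us)))

openSlots-degreesL : ∀ ts r → openSlots (length ts + r) (degreesL ts) ≡ just r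
openSlots-degreesL []             r = refl
openSlots-degreesL (node cs ∷ ts) r = trans
  (openSlots-++ (length cs + (length ts + r)) (degreesL cs) (degreesL ts) (openSlots-degreesL cs (length ts + r)))
  (openSlots-degreesL ts r)

degrees-isŁukasiewicz : ∀ t → IsŁukasiewicz (degrees t)
degrees-isŁukasiewicz (node ts) = openSlots-degreesL ts 0

decodeForest-degreesL : ∀ ts w → decodeForest (degreesL ts ++ w) ≡ ts ++ decodeForest w
decodeForest-degreesL []             w = refl
decodeForest-degreesL (node cs ∷ ts) w =
  trans (cong (λ F → node (take (length cs) F) ∷ drop (length cs) F) children)
        (cong₂ (λ xs ys → node xs ∷ ys) (take-length-++ cs _) (drop-length-++ cs _))
  where
  open ≡-Reasoning
  children : decodeForest ((degreesL cs ++ degreesL ts) ++ w) ≡ cs ++ (ts ++ decodeForest w)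
  children = begin
    decodeForest ((degreesL cs ++ degreesL ts) ++ w) ≡⟨ cong decodeForest (++-assoc (degreesL cs) _ w) ⟩
    decodeForest (degreesL cs ++ (degreesL ts ++ w)) ≡⟨ decodeForest-degreesL cs _ ⟩
    cs ++ decodeForest (degreesL ts ++ w)            ≡⟨ cong (cs ++_) (decodeForest-degreesL ts w) ⟩
    cs ++ (ts ++ decodeForest w)                     ∎

decode-degrees : ∀ t → decode (degrees t) ≡ t
decode-degrees (node ts) = cong node (begin
  take (length ts) (decodeForest (degreesL ts))       ≡⟨ cong (take (length ts) ∘ decodeForest) (++-identityʳ _) ⟨
  take (length ts) (decodeForest (degreesL ts ++ [])) ≡⟨ cong (take (length ts)) (decodeForest-degreesL ts []) ⟩
  take (length ts) (ts ++ [])                         ≡⟨ take-length-++ ts [] ⟩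
  ts                                                  ∎)
  where open ≡-Reasoning

length-decodeForest : ∀ r w → openSlots r w ≡ just 0 → length (decodeForest w) ≡ r
length-decodeForest zero    []      _ = refl
length-decodeForest (suc r) (d ∷ w) c = cong suc (begin
  length (drop d (decodeForest w)) ≡⟨ length-drop d (decodeForest w) ⟩
  length (decodeForest w) ∸ d      ≡⟨ cong (_∸ d) (length-decodeForest (d + r) w c) ⟩
  d + r ∸ d                        ≡⟨ m+n∸m≡n d r ⟩
  r                                ∎)
  where open ≡-Reasoning

length-take-decodeForest : ∀ r d w → openSlots (d + r) w ≡ just 0 → length (take d (decodeForest w)) ≡ d
length-take-decodeForest r d w c = trans (length-take d (decodeForest w))
  (m≤n⇒m⊓n≡m (subst (d ≤_) (sym (length-decodeForest (d + r) w c)) (m≤m+n d r)))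

degreesL-decodeForest : ∀ r w → openSlots r w ≡ just 0 → degreesL (decodeForest w) ≡ w
degreesL-decodeForest zero    []      _ = refl
degreesL-decodeForest (suc r) (d ∷ w) c = cong₂ _∷_ (length-take-decodeForest r d w c) (begin
  degreesL (take d F) ++ degreesL (drop d F) ≡⟨ degreesL-++ (take d F) (drop d F) ⟨
  degreesL (take d F ++ drop d F)            ≡⟨ cong degreesL (take++drop≡id d F) ⟩
  degreesL F                                 ≡⟨ degreesL-decodeForest (d + r) w c ⟩
  w                                          ∎)
  where
  open ≡-Reasoning
  F : List PlaneTree
  F = decodeForest w

degrees-decode : ∀ w → IsŁukasiewicz w → degrees (decode w) ≡ w
degrees-decode (d ∷ w) c = cong₂ _∷_ (length-take-decodeForest 0 d w c)
  (trans (cong degreesL (take-all d F (≤-reflexive (trans (length-decodeForest (d + 0) w c) (+-identityʳ d)))))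
         (degreesL-decodeForest (d + 0) w c))
  where
  F : List PlaneTree
  F = decodeForest w

mutual
  sum-degrees : ∀ t → sum (degrees t) ≡ edges t
  sum-degrees (node ts) = cong (length ts +_) (sum-degreesL ts)

  sum-degreesL : ∀ ts → sum (degreesL ts) ≡ edgesL ts
  sum-degreesL []       = refl
  sum-degreesL (t ∷ ts) = trans (sum-++ (degrees t) _) (cong₂ _+_ (sum-degrees t) (sum-degreesL ts))

mutual
  countAbove0-degrees : ∀ t → countAbove 0 (degrees t) ≡ internalNodes t
  countAbove0-degrees (node [])       = refl
  countAbove0-degrees (node (t ∷ ts)) = cong suc (countAbove0-degreesL (t ∷ ts))

  countAbove0-degreesL : ∀ ts → countAbove 0 (degreesL ts) ≡ internalNodesL ts
  countAbove0-degreesL []       = refl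
  countAbove0-degreesL (t ∷ ts) =
    trans (countAbove-++ 0 (degrees t) _) (cong₂ _+_ (countAbove0-degrees t) (countAbove0-degreesL ts))

mutual
  countAbove1-degrees : ∀ t → countAbove 1 (degrees t) ≡ bigNodes t
  countAbove1-degrees (node [])           = refl
  countAbove1-degrees (node (t ∷ []))     = countAbove1-degreesL (t ∷ [])
  countAbove1-degrees (node (t ∷ u ∷ ts)) = cong suc (countAbove1-degreesL (t ∷ u ∷ ts))

  countAbove1-degreesL : ∀ ts → countAbove 1 (degreesL ts) ≡ bigNodesL ts
  countAbove1-degreesL []       = refl
  countAbove1-degreesL (t ∷ ts) =
    trans (countAbove-++ 1 (degrees t) _) (cong₂ _+_ (countAbove1-degrees t) (countAbove1-degreesL ts))

Trees : ℕ → ℕ → ℕ → Set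
Trees n k m = Σ PlaneTree (λ t → edges t ≡ n × internalNodes t ≡ k × bigNodes t ≡ m)

ŁukasiewiczWords : ℕ → ℕ → ℕ → Set
ŁukasiewiczWords n k m = Σ (List ℕ) (λ w → IsŁukasiewicz w × Stats n k m w)

module _ {n k m : ℕ} where

  Stats-degrees : ∀ t → edges t ≡ n × internalNodes t ≡ k × bigNodes t ≡ m → Stats n k m (degrees t)
  Stats-degrees t (e , i , b) =
    trans (sum-degrees t) e , trans (countAbove0-degrees t) i , trans (countAbove1-degrees t) b

  Stats-degrees⁻ : ∀ t → Stats n k m (degrees t) → edges t ≡ n × internalNodes t ≡ k × bigNodes t ≡ m
  Stats-degrees⁻ t (e , i , b) =
    trans (sym (sum-degrees t)) e , trans (sym (countAbove0-degrees t)) i , trans (sym (countAbove1-degrees t)) b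

  trees↔ŁukasiewiczWords : Trees n k m ↔ ŁukasiewiczWords n k m
  trees↔ŁukasiewiczWords = Σ-irrelevant-↔
    (λ _ → ×-irrelevant uip (×-irrelevant uip uip)) (λ w → ×-irrelevant uip (Stats-irrelevant w))
    (λ (t , s) → degrees t , degrees-isŁukasiewicz t , Stats-degrees t s)
    (λ (w , ł , s) → decode w , Stats-degrees⁻ (decode w) (subst (Stats n k m) (sym (degrees-decode w ł)) s))
    (λ (w , ł , _) → degrees-decode w ł)
    (λ (t , _) → decode-degrees t)

-- The cycle lemma

openSlots-++⁻ : ∀ r a b {h} → openSlots r (a ++ b) ≡ just h →
  Σ ℕ λ i → openSlots r a ≡ just i × openSlots i b ≡ just h
openSlots-++⁻ r       []      b e = r , refl , e
openSlots-++⁻ (suc r) (d ∷ a) b e = openSlots-++⁻ (d + r) a b e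

openSlots-length : ∀ r w {h} → openSlots r w ≡ just h → h + length w ≡ r + sum w
openSlots-length r       []      refl = refl
openSlots-length (suc r) (d ∷ w) {h} e = begin
  h + suc (length w)    ≡⟨ +-suc h (length w) ⟩
  suc (h + length w)    ≡⟨ cong suc (openSlots-length (d + r) w e) ⟩
  suc (d + r + sum w)   ≡⟨ cong suc (trans (+-assoc d r (sum w)) (+-left-comm d r (sum w))) ⟩
  suc (r + (d + sum w)) ∎
  where open ≡-Reasoning

openSlots-+ : ∀ r w {h} c → openSlots r w ≡ just h → openSlots (r + c) w ≡ just (h + c)
openSlots-+ r       []      c refl = refl
openSlots-+ (suc r) (d ∷ w) c e    =
  trans (cong (λ s → openSlots s w) (sym (+-assoc d r c))) (openSlots-+ (d + r) w c e)

Łukasiewicz-length : ∀ w {n} → IsŁukasiewicz w → sum w ≡ n → length w ≡ suc n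
Łukasiewicz-length w ł refl = openSlots-length 1 w ł

Łukasiewicz-prefix : ∀ u y v → IsŁukasiewicz (u ++ y ∷ v) →
  Σ ℕ λ i → openSlots 1 u ≡ just (suc i) × openSlots (suc i) (y ∷ v) ≡ just 0
Łukasiewicz-prefix u y v ł with openSlots-++⁻ 1 u (y ∷ v) ł
... | suc i , p , q = i , p , q

-- y ∷ v would take suc i open slots down to none and a single slot up to suc j,
-- so by openSlots-length its length would be both its sum plus suc i and its sum minus j.
no-two-Łukasiewicz-rotations : ∀ x u y v →
  IsŁukasiewicz (x ∷ u ++ y ∷ v) → ¬ IsŁukasiewicz (y ∷ v ++ x ∷ u)
no-two-Łukasiewicz-rotations x u y v ł₁ ł₂
  with Łukasiewicz-prefix (x ∷ u) y v ł₁ | Łukasiewicz-prefix (y ∷ v) x u ł₂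
... | i , _ , from-suc-i | j , from-one , _ = m≢1+n+m s {j + i} (begin
  s                 ≡⟨ suc-injective (openSlots-length 1 (y ∷ v) from-one) ⟨
  j + ℓ             ≡⟨ cong (j +_) (openSlots-length (suc i) (y ∷ v) from-suc-i) ⟩
  j + suc (i + s)   ≡⟨ +-suc j (i + s) ⟩
  suc (j + (i + s)) ≡⟨ cong suc (+-assoc j i s) ⟨
  suc (j + i + s)   ∎)
  where
  open ≡-Reasoning
  s ℓ : ℕ
  s = sum (y ∷ v)
  ℓ = length (y ∷ v)

++-≡-++ : ∀ (a b a′ b′ : List ℕ) → a ++ b ≡ a′ ++ b′ →
  Σ (List ℕ) (λ c → a′ ≡ a ++ c × b ≡ c ++ b′) ⊎ Σ (List ℕ) (λ c → a ≡ a′ ++ c × b′ ≡ c ++ b)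
++-≡-++ []      b a′       b′ e = inj₁ (a′ , refl , e)
++-≡-++ (x ∷ a) b []       b′ e = inj₂ (x ∷ a , refl , sym e)
++-≡-++ (x ∷ a) b (y ∷ a′) b′ e with ∷-injective e
... | refl , e′ with ++-≡-++ a b a′ b′ e′
...   | inj₁ (c , p , q) = inj₁ (c , cong (x ∷_) p , q)
...   | inj₂ (c , p , q) = inj₂ (c , cong (x ∷_) p , q)

Łukasiewicz-rotation-unique : ∀ a x b a′ x′ b′ → a ++ x ∷ b ≡ a′ ++ x′ ∷ b′ →
  IsŁukasiewicz (x ∷ b ++ a) → IsŁukasiewicz (x′ ∷ b′ ++ a′) → a ≡ a′ × x ∷ b ≡ x′ ∷ b′
Łukasiewicz-rotation-unique a x b a′ x′ b′ e ł ł′ with ++-≡-++ a (x ∷ b) a′ (x′ ∷ b′) e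
... | inj₁ ([] , p , q) = sym (trans p (++-identityʳ a)) , q
... | inj₂ ([] , p , q) = trans p (++-identityʳ a′) , sym q
... | inj₁ (y ∷ c , refl , refl) = ⊥-elim (no-two-Łukasiewicz-rotations y c x′ (b′ ++ a)
  (subst IsŁukasiewicz (cong (y ∷_) (++-assoc c (x′ ∷ b′) a)) ł)
  (subst IsŁukasiewicz (cong (x′ ∷_) (sym (++-assoc b′ a (y ∷ c)))) ł′))
... | inj₂ (y ∷ c , refl , refl) = ⊥-elim (no-two-Łukasiewicz-rotations y c x (b ++ a′)
  (subst IsŁukasiewicz (cong (y ∷_) (++-assoc c (x ∷ b) a′)) ł′)
  (subst IsŁukasiewicz (cong (x ∷_) (sym (++-assoc b a′ (y ∷ c)))) ł))

-- front codes a forest of `trees` trees, and first ∷ back, read from a single open slot, never runs out.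
-- When slots ≡ trees, the rotation first ∷ back ++ front is therefore a Łukasiewicz word.
record Cut (w : List ℕ) : Set where
  constructor cut
  field
    front        : List ℕ
    first        : ℕ
    back         : List ℕ
    trees        : ℕ
    slots        : ℕ
    splits       : w ≡ front ++ first ∷ back
    front-forest : openSlots trees front ≡ just 0
    back-slots   : openSlots 1 (first ∷ back) ≡ just slots

-- A new first letter d joins the forest if d ≤ trees, and otherwise starts the cut itself.
cut-∷ : ∀ d v → Cut (d ∷ v)
cut-∷ d []      = cut [] d [] 0 (d + 0) refl refl refl
cut-∷ d (y ∷ v) with cut-∷ y v
... | cut a x b p q splits forest slots with d ≤? p
...   | yes d≤p with t , refl ← m≤n⇒∃[o]m+o≡n d≤p =
  cut (d ∷ a) x b (suc t) q (cong (d ∷_) splits) forest slots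
...   | no d≰p  with c , refl ← m≤n⇒∃[o]m+o≡n (≰⇒> d≰p) = cut [] d (y ∷ v) 0 (q + c) refl refl (begin
  openSlots (suc p + c + 0) (y ∷ v)  ≡⟨ cong₂ openSlots (trans (+-identityʳ _) (sym (+-suc p c))) splits ⟩
  openSlots (p + suc c) (a ++ x ∷ b) ≡⟨ openSlots-++ (p + suc c) a (x ∷ b) (openSlots-+ p a (suc c) forest) ⟩
  openSlots (suc c) (x ∷ b)          ≡⟨ openSlots-+ 1 (x ∷ b) c slots ⟩
  just (q + c)                       ∎)
  where open ≡-Reasoning

cutWord : ∀ {n} v → length v ≡ suc n → Cut v
cutWord (d ∷ v) _ = cut-∷ d v

cut-rotation-Łukasiewicz : ∀ {w} (c : Cut w) → length w ≡ suc (sum w) →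
  IsŁukasiewicz (Cut.first c ∷ Cut.back c ++ Cut.front c)
cut-rotation-Łukasiewicz (cut a x b p q refl forest slots) ℓ≡1+s =
  trans (openSlots-++ 1 (x ∷ b) a slots) (trans (cong (λ r → openSlots r a) q≡p) forest)
  where
  open ≡-Reasoning
  la lxb : ℕ
  la  = length a
  lxb = length (x ∷ b)
  la+lxb≡ : la + lxb ≡ suc (sum a + sum (x ∷ b))
  la+lxb≡ = trans (sym (length-++ a)) (trans ℓ≡1+s (cong suc (sum-++ a (x ∷ b))))
  q≡p : q ≡ p
  q≡p = +-cancelʳ-≡ (la + lxb) q p (begin
    q + (la + lxb)                  ≡⟨ +-left-comm q la lxb ⟩
    la + (q + lxb)                  ≡⟨ cong₂ _+_ (openSlots-length p a forest) (openSlots-length 1 (x ∷ b) slots) ⟩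
    p + sum a + suc (sum (x ∷ b))   ≡⟨ +-assoc p (sum a) _ ⟩
    p + (sum a + suc (sum (x ∷ b))) ≡⟨ cong (p +_) (trans (+-suc (sum a) _) (sym la+lxb≡)) ⟩
    p + (la + lxb)                  ∎)

Words : ℕ → ℕ → ℕ → Set
Words n k m = Σ (List ℕ) (λ v → length v ≡ suc n × Stats n k m v)

additive-swap : (f : List ℕ → ℕ) → (∀ xs ys → f (xs ++ ys) ≡ f xs + f ys) →
  ∀ xs ys → f (xs ++ ys) ≡ f (ys ++ xs)
additive-swap f f-++ xs ys = trans (f-++ xs ys) (trans (+-comm (f xs) (f ys)) (sym (f-++ ys xs)))

Stats-swap : ∀ {n k m} xs ys → Stats n k m (xs ++ ys) → Stats n k m (ys ++ xs)
Stats-swap xs ys (s , i , b) =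
  trans (additive-swap sum sum-++ ys xs) s ,
  trans (additive-swap (countAbove 0) (countAbove-++ 0) ys xs) i ,
  trans (additive-swap (countAbove 1) (countAbove-++ 1) ys xs) b

rotate : ℕ → List ℕ → List ℕ
rotate j w = drop (suc j) w ++ take (suc j) w

length-rotate : ∀ j w → length (rotate j w) ≡ length w
length-rotate j w = trans (additive-swap length (λ xs _ → length-++ xs) (drop (suc j) w) (take (suc j) w))
                          (cong length (take++drop≡id (suc j) w))

Stats-rotate : ∀ {n k m} j w → Stats n k m w → Stats n k m (rotate j w)
Stats-rotate j w s = Stats-swap (take (suc j) w) (drop (suc j) w) (subst (Stats _ _ _) (sym (take++drop≡id (suc j) w)) s)

module _ {n k m : ℕ} where

  MarkedŁukasiewiczWords : Set
  MarkedŁukasiewiczWords = Σ (Fin (suc n) × List ℕ) (λ (_ , w) → IsŁukasiewicz w × Stats n k m w)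

  rotateWord : MarkedŁukasiewiczWords → Words n k m
  rotateWord ((i , w) , ł , s) =
    rotate (toℕ i) w , trans (length-rotate (toℕ i) w) (Łukasiewicz-length w ł (proj₁ s)) , Stats-rotate (toℕ i) w s

  unrotateWord : Words n k m → MarkedŁukasiewiczWords
  unrotateWord (v , ℓ , s) =
    (fromℕ< back<1+n , first ∷ back ++ front) ,
    cut-rotation-Łukasiewicz c (trans ℓ (cong suc (sym (proj₁ s)))) ,
    Stats-swap front (first ∷ back) (subst (Stats n k m) splits s)
    where
    c : Cut v
    c = cutWord v ℓ
    open Cut c
    back<1+n : length back < suc n
    back<1+n = subst (suc (length back) ≤_) (trans (sym (length-++ front)) (trans (cong length (sym splits)) ℓ))
                     (m≤n+m _ (length front))

  rotate-unrotate : ∀ y → proj₁ (rotateWord (unrotateWord y)) ≡ proj₁ y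
  rotate-unrotate (v , ℓ , s) = begin
    rotate (toℕ (fromℕ< _)) (first ∷ back ++ front) ≡⟨ cong (λ j → rotate j (first ∷ back ++ front))
                                                             (toℕ-fromℕ< _) ⟩
    rotate (length back) (first ∷ back ++ front)    ≡⟨ cong₂ _++_ (drop-length-++ (first ∷ back) front)
                                                                  (take-length-++ (first ∷ back) front) ⟩
    front ++ first ∷ back                           ≡⟨ splits ⟨
    v                                               ∎
    where
    open ≡-Reasoning
    open Cut (cutWord v ℓ)

  unrotate-rotate : ∀ x → proj₁ (unrotateWord (rotateWord x)) ≡ proj₁ x
  unrotate-rotate x@((i , y ∷ w) , ł , s) = cong₂ _,_ (toℕ-injective (trans (toℕ-fromℕ< _) index)) word
    where
    open ≡-Reasoning
    j : ℕ
    j = toℕ i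
    open Cut (cutWord (drop j w ++ y ∷ take j w) (proj₁ (proj₂ (rotateWord x))))
    unique : front ≡ drop j w × first ∷ back ≡ y ∷ take j w
    unique = Łukasiewicz-rotation-unique front first back (drop j w) y (take j w) (sym splits)
      (proj₁ (proj₂ (unrotateWord (rotateWord x))))
      (subst IsŁukasiewicz (cong (y ∷_) (sym (take++drop≡id j w))) ł)
    word : first ∷ back ++ front ≡ y ∷ w
    word = trans (cong₂ _++_ (proj₂ unique) (proj₁ unique)) (cong (y ∷_) (take++drop≡id j w))
    j≤length-w : j ≤ length w
    j≤length-w = s≤s⁻¹ (subst (j <_) (sym (Łukasiewicz-length (y ∷ w) ł (proj₁ s))) (toℕ<n i))
    index : length back ≡ j
    index = begin
      length back       ≡⟨ cong (pred ∘ length) (proj₂ unique) ⟩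
      length (take j w) ≡⟨ length-take j w ⟩
      j ⊓ length w      ≡⟨ m≤n⇒m⊓n≡m j≤length-w ⟩
      j                 ∎

  cycle-lemma : (Fin (suc n) × ŁukasiewiczWords n k m) ↔ Words n k m
  cycle-lemma = ↔-trans (↔-sym Σ-assoc) (Σ-irrelevant-↔
    (λ (_ , w) → ×-irrelevant uip (Stats-irrelevant w)) (λ v → ×-irrelevant uip (Stats-irrelevant v))
    rotateWord unrotateWord rotate-unrotate unrotate-rotate)

-- Counting words

predPositives : List ℕ → List ℕ
predPositives []          = []
predPositives (zero ∷ v)  = predPositives v
predPositives (suc y ∷ v) = y ∷ predPositives v

sum-predPositives : ∀ v → sum v ≡ countAbove 0 v + sum (predPositives v)
sum-predPositives []          = refl
sum-predPositives (zero ∷ v)  = sum-predPositives v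
sum-predPositives (suc y ∷ v) =
  cong suc (trans (cong (y +_) (sum-predPositives v)) (+-left-comm y (countAbove 0 v) (sum (predPositives v))))

countAbove-predPositives : ∀ j v → countAbove (suc j) v ≡ countAbove j (predPositives v)
countAbove-predPositives j []          = refl
countAbove-predPositives j (zero ∷ v)  = countAbove-predPositives j v
countAbove-predPositives j (suc y ∷ v) with j <ᵇ y
... | true  = cong suc (countAbove-predPositives j v)
... | false = countAbove-predPositives j v

Fin-Pascal-↔ : ∀ L k → Fin (suc L C suc k) ↔ (Fin (L C suc k) ⊎ Fin (L C k))
Fin-Pascal-↔ L k =
  ↔-trans (≡⇒ (cong Fin (trans (sym (nCk+nC[k+1]≡[n+1]C[k+1] L k)) (+-comm (L C k) (L C suc k))))) +↔⊎

Lists : ℕ → (List ℕ → Set) → Set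
Lists k P = Σ (List ℕ) (λ u → length u ≡ k × P u)

Positions : ℕ → ℕ → (List ℕ → Set) → Set
Positions L k P = Σ (List ℕ) (λ v → length v ≡ L × countAbove 0 v ≡ k × P (predPositives v))

-- A word is determined by the positions of its positive letters and by those letters, each decreased by one.
positions-↔ : ∀ L k (P : List ℕ → Set) → Positions L k P ↔ (Fin (L C k) × Lists k P)
positions-↔ zero zero P = mk↔ₛ′
  (λ { ([] , _ , _ , p) → zero , [] , refl , p })
  (λ { (zero , [] , _ , p) → [] , refl , refl , p })
  (λ { (zero , [] , refl , p) → refl })
  (λ { ([] , refl , refl , p) → refl })
positions-↔ zero (suc k) P = mk↔ₛ′ (λ { ([] , _ , () , _) }) (λ ()) (λ ()) (λ { ([] , _ , () , _) })
positions-↔ (suc L) k P = ↔-trans Σ-List-∷-↔ (↔-trans Σ-ℕ-↔ (by-first-letter k))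
  where
  open EquationalReasoning
  Positive : ℕ → Set
  Positive k =
    Σ ℕ (λ y → Σ (List ℕ) (λ v → length v ≡ L × suc (countAbove 0 v) ≡ k × P (y ∷ predPositives v)))
  by-first-letter : ∀ k → (Positions L k P ⊎ Positive k) ↔ (Fin (suc L C k) × Lists k P)
  by-first-letter zero    = ↔-trans (⊎-emptyʳ-↔ (λ { (_ , _ , _ , () , _) })) (positions-↔ L zero P)
  by-first-letter (suc k) = begin
    (Positions L (suc k) P ⊎ Positive (suc k))
      ↔⟨ positions-↔ L (suc k) P ⊎-↔ congˡ (congˡ (↔-refl ×-↔ (suc-≡-↔ ×-↔ ↔-refl))) ⟩
    ((Fin (L C suc k) × Lists (suc k) P) ⊎ Σ ℕ (λ y → Positions L k (λ u → P (y ∷ u))))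
      ↔⟨ ↔-refl ⊎-↔ congˡ (positions-↔ L k _) ⟩
    ((Fin (L C suc k) × Lists (suc k) P) ⊎ Σ ℕ (λ y → Fin (L C k) × Lists k (λ u → P (y ∷ u))))
      ↔⟨ ↔-refl ⊎-↔ ↔-trans Σ-×-factorˡ (↔-refl ×-↔ ↔-sym Σ-List-∷-↔) ⟩
    ((Fin (L C suc k) × Lists (suc k) P) ⊎ (Fin (L C k) × Lists (suc k) P))
      ↔⟨ ↔-sym ×-distribʳ-⊎ ⟩
    ((Fin (L C suc k) ⊎ Fin (L C k)) × Lists (suc k) P)
      ↔⟨ ↔-sym (Fin-Pascal-↔ L k) ×-↔ ↔-refl ⟩
    (Fin (suc L C suc k) × Lists (suc k) P)
      ∎

compositions : ℕ → ℕ → ℕ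
compositions zero    zero    = 1
compositions zero    (suc s) = 0
compositions (suc m) zero    = compositions m zero
compositions (suc m) (suc s) = compositions m (suc s) + compositions (suc m) s

compositions-↔ : ∀ m s → Lists m (λ z → sum z ≡ s) ↔ Fin (compositions m s)
compositions-↔ zero zero    =
  ↔-trans Σ-List-[]-↔ (mk↔ₛ′ (λ _ → zero) (λ _ → refl) (λ { zero → refl }) (λ { refl → refl }))
compositions-↔ zero (suc s) = ↔-trans Σ-List-[]-↔ (mk↔ₛ′ (λ ()) (λ ()) (λ ()) (λ ()))
compositions-↔ (suc m) s    = ↔-trans Σ-List-∷-↔ (↔-trans Σ-ℕ-↔ (by-first-part s))
  where
  open EquationalReasoning
  Positive : ℕ → Set
  Positive s = Σ ℕ (λ x → Lists m (λ z → suc (x + sum z) ≡ s))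
  by-first-part : ∀ s → (Lists m (λ z → sum z ≡ s) ⊎ Positive s) ↔ Fin (compositions (suc m) s)
  by-first-part zero    = ↔-trans (⊎-emptyʳ-↔ (λ { (_ , _ , _ , ()) })) (compositions-↔ m zero)
  by-first-part (suc s) = begin
    (Lists m (λ z → sum z ≡ suc s) ⊎ Positive (suc s))
      ↔⟨ compositions-↔ m (suc s) ⊎-↔ ↔-trans (congˡ (congˡ (↔-refl ×-↔ suc-≡-↔))) (↔-sym Σ-List-∷-↔) ⟩
    (Fin (compositions m (suc s)) ⊎ Lists (suc m) (λ z → sum z ≡ s))
      ↔⟨ ↔-refl ⊎-↔ compositions-↔ (suc m) s ⟩
    (Fin (compositions m (suc s)) ⊎ Fin (compositions (suc m) s))
      ↔⟨ ↔-sym +↔⊎ ⟩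
    Fin (compositions (suc m) (suc s))
      ∎

shiftedCompositions : ℕ → ℕ → ℕ → ℕ
shiftedCompositions zero    m n       = compositions m n
shiftedCompositions (suc c) m zero    = 0
shiftedCompositions (suc c) m (suc n) = shiftedCompositions c m n

shiftedCompositions-↔ : ∀ c m n → Lists m (λ z → c + sum z ≡ n) ↔ Fin (shiftedCompositions c m n)
shiftedCompositions-↔ zero    m n       = compositions-↔ m n
shiftedCompositions-↔ (suc c) m zero    = mk↔ₛ′ (λ { (_ , _ , ()) }) (λ ()) (λ ()) (λ { (_ , _ , ()) })
shiftedCompositions-↔ (suc c) m (suc n) = ↔-trans (congˡ (↔-refl ×-↔ suc-≡-↔)) (shiftedCompositions-↔ c m n)

wordCount : ℕ → ℕ → ℕ → ℕ
wordCount n k m = (suc n C k) * ((k C m) * shiftedCompositions (k + m) m n)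

module _ {n k m : ℕ} where

  InternalExcesses : List ℕ → Set
  InternalExcesses u = k + sum u ≡ n × countAbove 0 u ≡ m

  BigExcesses : List ℕ → Set
  BigExcesses z = k + (m + sum z) ≡ n

  words-↔-positions : Words n k m ↔ Positions (suc n) k InternalExcesses
  words-↔-positions = congˡ λ {v} → irrelevant-↔
    (×-irrelevant uip (Stats-irrelevant v)) (×-irrelevant uip (×-irrelevant uip (×-irrelevant uip uip)))
    (λ (ℓ , s , i , b) → ℓ , i , trans (cong (_+ _) (sym i)) (trans (sym (sum-predPositives v)) s) ,
                         trans (sym (countAbove-predPositives 0 v)) b)
    (λ (ℓ , i , s , b) → ℓ , trans (sum-predPositives v) (trans (cong (_+ _) i) s) , i ,
                         trans (countAbove-predPositives 0 v) b)

  lists-↔-positions : Lists k InternalExcesses ↔ Positions k m BigExcesses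
  lists-↔-positions = congˡ λ {u} → irrelevant-↔
    (×-irrelevant uip (×-irrelevant uip uip)) (×-irrelevant uip (×-irrelevant uip uip))
    (λ (ℓ , s , i) → ℓ , i ,
      trans (cong (λ x → k + (x + _)) (sym i)) (trans (cong (k +_) (sym (sum-predPositives u))) s))
    (λ (ℓ , i , s) → ℓ ,
      trans (cong (k +_) (sum-predPositives u)) (trans (cong (λ x → k + (x + _)) i) s) , i)

  words-↔ : Words n k m ↔ Fin (wordCount n k m)
  words-↔ = begin
    Words n k m                                             ↔⟨ words-↔-positions ⟩
    Positions (suc n) k InternalExcesses                    ↔⟨ positions-↔ (suc n) k InternalExcesses ⟩
    (Fin (suc n C k) × Lists k InternalExcesses)            ↔⟨ ↔-refl ×-↔ lists-↔-positions ⟩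
    (Fin (suc n C k) × Positions k m BigExcesses)           ↔⟨ ↔-refl ×-↔ positions-↔ k m BigExcesses ⟩
    (Fin (suc n C k) × (Fin (k C m) × Lists m BigExcesses))
      ↔⟨ ↔-refl ×-↔ ↔-refl ×-↔ congˡ (↔-refl ×-↔ ≡⇒ (cong (_≡ n) (sym (+-assoc k m _)))) ⟩
    (Fin (suc n C k) × (Fin (k C m) × Lists m (λ z → k + m + sum z ≡ n)))
      ↔⟨ ↔-refl ×-↔ ↔-refl ×-↔ shiftedCompositions-↔ (k + m) m n ⟩
    (Fin (suc n C k) × (Fin (k C m) × Fin (shiftedCompositions (k + m) m n)))
      ↔⟨ ↔-sym (↔-trans *↔× (↔-refl ×-↔ *↔×)) ⟩
    Fin (wordCount n k m)                                   ∎
    where open EquationalReasoning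

-- Binomial arithmetic

[1+k]*[1+n]C[1+k]≡[1+n]*nCk : ∀ n k → suc k * (suc n C suc k) ≡ suc n * (n C k)
[1+k]*[1+n]C[1+k]≡[1+n]*nCk zero    zero    = refl
[1+k]*[1+n]C[1+k]≡[1+n]*nCk zero    (suc k) = *-zeroʳ (suc (suc k))
[1+k]*[1+n]C[1+k]≡[1+n]*nCk (suc n) zero    =
  trans (*-identityˡ _) (trans (nC1≡n (suc (suc n))) (sym (*-identityʳ _)))
[1+k]*[1+n]C[1+k]≡[1+n]*nCk (suc n) (suc k) = begin
  suc (suc k) * (suc (suc n) C suc (suc k))   ≡⟨ cong (suc (suc k) *_) (nCk+nC[k+1]≡[n+1]C[k+1] (suc n) (suc k)) ⟨
  suc (suc k) * (a + b)                       ≡⟨ *-distribˡ-+ (suc (suc k)) a b ⟩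
  a + suc k * a + suc (suc k) * b             ≡⟨ cong₂ (λ x y → a + x + y) ([1+k]*[1+n]C[1+k]≡[1+n]*nCk n k)
                                                                         ([1+k]*[1+n]C[1+k]≡[1+n]*nCk n (suc k)) ⟩
  a + suc n * (n C k) + suc n * (n C suc k)   ≡⟨ +-assoc a _ _ ⟩
  a + (suc n * (n C k) + suc n * (n C suc k)) ≡⟨ cong (a +_) (*-distribˡ-+ (suc n) (n C k) (n C suc k)) ⟨
  a + suc n * (n C k + n C suc k)             ≡⟨ cong (λ x → a + suc n * x) (nCk+nC[k+1]≡[n+1]C[k+1] n k) ⟩
  suc (suc n) * a                             ∎
  where
  open ≡-Reasoning
  a b : ℕ
  a = suc n C suc k
  b = suc n C suc (suc k)

[1+n]Cn≡1+n : ∀ n → suc n C n ≡ suc n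
[1+n]Cn≡1+n n = trans (nCk≡nC[n∸k] (n≤1+n n)) (trans (cong (suc n C_) (m+n∸n≡m 1 n)) (nC1≡n (suc n)))

compositions-closed : ∀ m s → compositions (suc m) s ≡ (s + m) C m
compositions-closed zero    zero    = refl
compositions-closed zero    (suc s) = compositions-closed zero s
compositions-closed (suc m) zero    = trans (compositions-closed m zero) (trans (nCn≡1 m) (sym (nCn≡1 (suc m))))
compositions-closed (suc m) (suc s) = trans
  (cong₂ _+_ (trans (compositions-closed m (suc s)) (cong (_C m) (sym (+-suc s m)))) (compositions-closed (suc m) s))
  (nCk+nC[k+1]≡[n+1]C[k+1] (s + suc m) m)

shiftedCompositions-+ : ∀ c m s → shiftedCompositions c m (c + s) ≡ compositions m s
shiftedCompositions-+ zero    m s = refl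
shiftedCompositions-+ (suc c) m s = shiftedCompositions-+ c m s

shiftedCompositions-< : ∀ {c n} m → n < c → shiftedCompositions c m n ≡ 0
shiftedCompositions-< {suc c} {zero}  m _         = refl
shiftedCompositions-< {suc c} {suc n} m (s≤s n<c) = shiftedCompositions-< m n<c

shiftedCompositions-zero : ∀ c n → shiftedCompositions c 0 n ≡ (if n ≡ᵇ c then 1 else 0)
shiftedCompositions-zero zero    zero    = refl
shiftedCompositions-zero zero    (suc n) = refl
shiftedCompositions-zero (suc c) zero    = refl
shiftedCompositions-zero (suc c) (suc n) = shiftedCompositions-zero c n

≡ᵇ-reflects-≡ : ∀ m n → Reflects (m ≡ n) (m ≡ᵇ n)
≡ᵇ-reflects-≡ m n = fromEquivalence (≡ᵇ⇒≡ m n) (≡⇒≡ᵇ m n)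

wordCount-zero : ∀ n k → wordCount n k 0 ≡ (suc n C k) * (if n ≡ᵇ k then 1 else 0)
wordCount-zero n k = cong ((suc n C k) *_) (trans (*-identityˡ _)
  (trans (cong (λ c → shiftedCompositions c 0 n) (+-identityʳ k)) (shiftedCompositions-zero k n)))

module _ (n k m : ℕ) where

  wordCount-exterior : ¬ (suc m ≤ suc k × suc k + suc m ≤ n) → wordCount n (suc k) (suc m) ≡ 0
  wordCount-exterior outside with suc m ≤? suc k
  ... | no m≰k = trans (cong (λ x → (suc n C suc k) * (x * s)) (k>n⇒nCk≡0 (≰⇒> m≰k))) (*-zeroʳ (suc n C suc k))
    where
    s : ℕ
    s = shiftedCompositions (suc k + suc m) (suc m) n
  ... | yes m≤k = trans
    (cong (λ x → (suc n C suc k) * ((suc k C suc m) * x))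
          (shiftedCompositions-< (suc m) (≰⇒> (outside ∘ (m≤k ,_)))))
    (trans (cong ((suc n C suc k) *_) (*-zeroʳ (suc k C suc m))) (*-zeroʳ (suc n C suc k)))

  w-interior : suc m ≤ suc k → suc k + suc m ≤ n →
    w n (suc k) (suc m) ≡ ((n C k) * ((n ∸ suc k ∸ 1) C m) * (suc k C suc m)) / suc k
  w-interior m≤k k+m≤n
    with suc m ≤ᵇ suc k | ≤ᵇ-reflects-≤ (suc m) (suc k) | suc k + suc m ≤ᵇ n | ≤ᵇ-reflects-≤ (suc k + suc m) n
  ... | true  | _       | true  | _         = refl
  ... | false | ofⁿ m≰k | _     | _         = contradiction m≤k m≰k
  ... | true  | _       | false | ofⁿ k+m≰n = contradiction k+m≤n k+m≰n

  w-exterior : ¬ (suc m ≤ suc k × suc k + suc m ≤ n) → w n (suc k) (suc m) ≡ 0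
  w-exterior outside
    with suc m ≤ᵇ suc k | ≤ᵇ-reflects-≤ (suc m) (suc k) | suc k + suc m ≤ᵇ n | ≤ᵇ-reflects-≤ (suc k + suc m) n
  ... | true  | ofʸ m≤k | true  | ofʸ k+m≤n = contradiction (m≤k , k+m≤n) outside
  ... | true  | _       | false | _         = refl
  ... | false | _       | _     | _         = refl

module _ (k m r c : ℕ) where

  private
    N : ℕ
    N = suc k + suc m + r

  [N∸1+k]∸1≡m+r : N ∸ suc k ∸ 1 ≡ m + r
  [N∸1+k]∸1≡m+r =
    cong (_∸ 1) (trans (cong (_∸ suc k) (+-assoc (suc k) (suc m) r)) (m+n∸m≡n (suc k) (suc m + r)))

  count-is-w-interior : suc N * c ≡ wordCount N (suc k) (suc m) →
    c ≡ ((N C k) * ((N ∸ suc k ∸ 1) C m) * (suc k C suc m)) / suc k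
  count-is-w-interior e = sym (begin
    t / suc k         ≡⟨ cong (_/ suc k) c*[1+k]≡t ⟨
    c * suc k / suc k ≡⟨ m*n/n≡m c (suc k) ⟩
    c                 ∎)
    where
    open ≡-Reasoning
    b s t : ℕ
    b = suc k C suc m
    s = (m + r) C m
    t = (N C k) * ((N ∸ suc k ∸ 1) C m) * b
    e′ : suc N * c ≡ (suc N C suc k) * (b * s)
    e′ = trans e (cong (λ x → (suc N C suc k) * (b * x)) (trans (shiftedCompositions-+ (suc k + suc m) (suc m) r)
                                                               (trans (compositions-closed m r) (cong (_C m) (+-comm r m)))))
    c*[1+k]≡t : c * suc k ≡ t
    c*[1+k]≡t = *-cancelˡ-≡ _ _ (suc N) (begin
      suc N * (c * suc k)                 ≡⟨ cong (suc N *_) (*-comm c (suc k)) ⟩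
      suc N * (suc k * c)                 ≡⟨ *-left-comm (suc N) (suc k) c ⟩
      suc k * (suc N * c)                 ≡⟨ cong (suc k *_) e′ ⟩
      suc k * ((suc N C suc k) * (b * s)) ≡⟨ *-assoc (suc k) (suc N C suc k) (b * s) ⟨
      suc k * (suc N C suc k) * (b * s)   ≡⟨ cong (_* (b * s)) ([1+k]*[1+n]C[1+k]≡[1+n]*nCk N k) ⟩
      suc N * (N C k) * (b * s)           ≡⟨ *-assoc (suc N) (N C k) (b * s) ⟩
      suc N * ((N C k) * (b * s))         ≡⟨ cong (suc N *_) (*-left-comm (N C k) b s) ⟩
      suc N * (b * ((N C k) * s))         ≡⟨ cong (suc N *_) (*-comm b ((N C k) * s)) ⟩
      suc N * ((N C k) * s * b)           ≡⟨ cong (λ x → suc N * ((N C k) * (x C m) * b)) [N∸1+k]∸1≡m+r ⟨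
      suc N * t                           ∎)

count-is-w : ∀ n k m c → suc n * c ≡ wordCount n k m → c ≡ w n k m
count-is-w n k zero c e = count-is-w-zero (trans e (wordCount-zero n k))
  where
  count-is-w-zero : suc n * c ≡ (suc n C k) * (if n ≡ᵇ k then 1 else 0) → c ≡ w n k 0
  count-is-w-zero e′ with n ≡ᵇ k | ≡ᵇ-reflects-≡ n k
  ... | true  | ofʸ refl = *-cancelˡ-≡ c 1 (suc n)
    (trans e′ (trans (*-identityʳ (suc n C n)) (trans ([1+n]Cn≡1+n n) (sym (*-identityʳ (suc n))))))
  ... | false | ofⁿ _    = *-cancelˡ-≡ c 0 (suc n) (trans e′ (trans (*-zeroʳ (suc n C k)) (sym (*-zeroʳ (suc n)))))
count-is-w n zero (suc m) c e = *-cancelˡ-≡ c 0 (suc n) (trans e (sym (*-zeroʳ (suc n))))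
count-is-w n (suc k) (suc m) c e with suc m ≤? suc k ×-dec suc k + suc m ≤? n
... | yes (m≤k , k+m≤n) with r , refl ← m≤n⇒∃[o]m+o≡n k+m≤n =
  trans (count-is-w-interior k m r c e) (sym (w-interior _ k m m≤k k+m≤n))
... | no outside =
  trans (*-cancelˡ-≡ c 0 (suc n) (trans e (trans (wordCount-exterior n k m outside) (sym (*-zeroʳ (suc n))))))
        (sym (w-exterior n k m outside))

theorem1p1 : (n k m : ℕ) → 1 ≤ n →
    (Σ PlaneTree (λ t → edges t ≡ n × internalNodes t ≡ k × bigNodes t ≡ m)) ↔ Fin (w n k m)
theorem1p1 n k m _ =
  let c , trees↔c , count = Fin-×-cancelˡ counting
  in ↔-trans trees↔c (≡⇒ (cong Fin (count-is-w n k m c count)))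
  where
  open EquationalReasoning
  counting : (Fin (suc n) × Trees n k m) ↔ Fin (wordCount n k m)
  counting = begin
    (Fin (suc n) × Trees n k m)            ↔⟨ ↔-refl ×-↔ trees↔ŁukasiewiczWords ⟩
    (Fin (suc n) × ŁukasiewiczWords n k m) ↔⟨ cycle-lemma ⟩
    Words n k m                            ↔⟨ words-↔ ⟩
    Fin (wordCount n k m)                  ∎
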